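{- Let $\varphi$ be a sentence as in the context which satisfies: (I) every atom in $\psi$ contains at most one variable from $\vec{x}$, and (II) for all distinct $x,x'\in\vec{x}$ with $\mathrm{idx}(x)\le\mathrm{idx}(x')$ and every $y\in\bigcup_{i\ge\mathrm{idx}(x)}\vec{y}_i$ it holds $y\notin\mathrm{vars}(\mathcal{L}_x)\cap\mathrm{vars}(\mathcal{L}_{x'})$. Then: (i) for all distinct $x,x'\in\vec{x}$, $\mathcal{L}_x\cap\mathcal{L}_{x'}=\emptyset$; (ii) for every $x\in\vec{x}$, $\mathrm{vars}(\mathcal{L}_x)\cap\vec{x}=\{x\}$; (iii) for every $x\in\vec{x}$, $Y_x\cap\mathrm{vars}(\mathcal{L}_0)=\emptyset$; (iv) for all distinct $x,x'\in\vec{x}$ with $\mathrm{idx}(x)\le\mathrm{idx}(x')$, $Y_x\cap\mathrm{vars}(\mathcal{L}_{x'})=\emptyset$.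
   Context: Let $\varphi := \forall \vec{x}_1 \exists \vec{y}_1 \ldots \forall \vec{x}_n \exists \vec{y}_n.\,\psi$ be a sentence in standard form ($\vec{x}_i,\vec{y}_i$ tuples of variables, $\vec{x}_1$, $\vec{y}_n$ possibly empty; $\psi$ quantifier-free, in negation normal form, using only $\wedge,\vee,\neg$; every prefix variable occurs in $\psi$; no variable bound twice) without equality and without non-constant function symbols. Let $\vec{x}:=\bigcup_i\vec{x}_i$, $\vec{y}:=\bigcup_i\vec{y}_i$, $\mathrm{vars}(S)$ the set of variables in a set $S$ of literals, and $\mathrm{idx}(v):=k$ iff $v\in\vec{x}_k$ or $v\in\vec{y}_k$. Let $\mathcal{G}_\varphi$ be the directed graph with vertex set $\vec{y}$ and an edge $\langle y,y'\rangle$ iff $\mathrm{idx}(y)\le\mathrm{idx}(y')$ and some atom of $\psi$ contains both $y$ and $y'$. For $y\in\vec{y}$, the upward closure $\Cup_y$ is the smallest subset of $\vec{y}$ containing $y$ and closed under following edges of $\mathcal{G}_\varphi$; $\mathcal{L}(\Cup_y)$ is the set of literals of $\psi$ containing a variable from $\Cup_y$. For $x\in\vec{x}$, $\mathcal{L}_x$ is the smallest set of literals such that (a) every literal of $\psi$ in which $x$ occurs belongs to $\mathcal{L}_x$, and (b) for every $y\in\mathrm{vars}(\mathcal{L}_x)\cap\vec{y}$ with $\mathrm{idx}(y)\ge\mathrm{idx}(x)$ we have $\mathcal{L}(\Cup_y)\subseteq\mathcal{L}_x$. $\mathcal{L}_0$ is the set of literals of $\psi$ lying in no $\mathcal{L}_x$,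 $x\in\vec{x}$. $Y_x:=\mathrm{vars}(\mathcal{L}_x)\cap\bigcup_{i\ge\mathrm{idx}(x)}\vec{y}_i$. -}

module Defs where

open import Data.Nat using (ℕ; zero; suc; _≤_)
open import Data.List using (List; []; _∷_; _++_; concatMap)
open import Data.List.Membership.Propositional using (_∈_)
open import Data.List.Relation.Unary.Unique.Propositional using (Unique)
open import Data.Product using (Σ; ∃; ∃-syntax; _×_; _,_; proj₁; proj₂)
open import Data.Unit using (⊤)
open import Relation.Binary.PropositionalEquality using (_≡_; _≢_)
open import Relation.Nullary using (¬_)

-- Syntax: first-order, no equality, no non-constant function symbols.

Var : Set
Var = ℕ

data Term : Set where
  var   : Var → Term
  const : ℕ → Term

record Atom : Set where
  constructor atom
  field
    pred : ℕ
    args : List Term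

data Literal : Set where
  pos : Atom → Literal
  neg : Atom → Literal

data QF : Set where
  lit  : Literal → QF
  _∧ᶠ_ : QF → QF → QF
  _∨ᶠ_ : QF → QF → QF

varsTerm : Term → List Var
varsTerm (var v)   = v ∷ []
varsTerm (const _) = []

varsAtom : Atom → List Var
varsAtom (atom _ ts) = concatMap varsTerm ts

atomOf : Literal → Atom
atomOf (pos a) = a
atomOf (neg a) = a

varsLit : Literal → List Var
varsLit l = varsAtom (atomOf l)

lits : QF → List Literal
lits (lit l)    = l ∷ []
lits (φ ∧ᶠ ψ)   = lits φ ++ lits ψ
lits (φ ∨ᶠ ψ)   = lits φ ++ lits ψ

varsQF : QF → List Var
varsQF ψ = concatMap varsLit (lits ψ)

-- Sentences ∀x₁∃y₁…∀xₙ∃yₙ.ψ : the prefix is the list of blocks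
-- (x⃗ᵢ , y⃗ᵢ), i = 1 … n (the i-th list element has index i).

Block : Set
Block = List Var × List Var

record Sentence : Set where
  constructor sentence
  field
    prefix : List Block
    matrix : QF

-- y⃗ᵢ nonempty for i < n and x⃗ᵢ nonempty for i ≥ 2
Linked : List Block → Set
Linked []               = ⊤
Linked (_ ∷ [])         = ⊤
Linked (b ∷ b' ∷ bs)    = (proj₂ b ≢ []) × (proj₁ b' ≢ []) × Linked (b' ∷ bs)

allVars : List Block → List Var
allVars []             = []
allVars ((xs , ys) ∷ bs) = xs ++ ys ++ allVars bs

-- IsX bs v k : v ∈ x⃗ₖ (so idx(v) = k), blocks counted from 1
data IsX : List Block → Var → ℕ → Set where
  here  : ∀ {b bs v} → v ∈ proj₁ b → IsX (b ∷ bs) v 1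
  there : ∀ {b bs v k} → IsX bs v k → IsX (b ∷ bs) v (suc k)

data IsY : List Block → Var → ℕ → Set where
  here  : ∀ {b bs v} → v ∈ proj₂ b → IsY (b ∷ bs) v 1
  there : ∀ {b bs v k} → IsY bs v k → IsY (b ∷ bs) v (suc k)

record WellFormed (φ : Sentence) : Set where
  open Sentence φ
  field
    nonEmptyPrefix : prefix ≢ []
    linked         : Linked prefix
    noDoubleBind   : Unique (allVars prefix)
    prefixOccurs   : ∀ v → v ∈ allVars prefix → v ∈ varsQF matrix
    closed         : ∀ v → v ∈ varsQF matrix → v ∈ allVars prefix

module _ (φ : Sentence) where
  open Sentence φ

  XVar : Var → Set
  XVar v = ∃[ k ] IsX prefix v k

  YVar : Var → Set
  YVar v = ∃[ k ] IsY prefix v k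

  Edge : Var → Var → Set
  Edge y y' = ∃[ i ] ∃[ j ] (IsY prefix y i × IsY prefix y' j × i ≤ j ×
              ∃[ l ] (l ∈ lits matrix × y ∈ varsLit l × y' ∈ varsLit l))

  data Up (y : Var) : Var → Set where
    base : YVar y → Up y y
    step : ∀ {z z'} → Up y z → Edge z z' → Up y z'

  LUp : Var → Literal → Set
  LUp y l = l ∈ lits matrix × ∃[ z ] (Up y z × z ∈ varsLit l)

  varsOf : (Literal → Set) → Var → Set
  varsOf S v = ∃[ l ] (S l × v ∈ varsLit l)

  data L (x : Var) : Literal → Set where
    ruleA : ∀ {l} → l ∈ lits matrix → x ∈ varsLit l → L x l
    ruleB : ∀ {l' y i j l} → L x l' → y ∈ varsLit l' →
            IsY prefix y j → IsX prefix x i → i ≤ j →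
            LUp y l → L x l

  L0 : Literal → Set
  L0 l = l ∈ lits matrix × (∀ x → XVar x → ¬ L x l)

  Yx : Var → Var → Set
  Yx x y = varsOf (L x) y × ∃[ i ] ∃[ j ] (IsX prefix x i × IsY prefix y j × i ≤ j)

  CondI : Set
  CondI = ∀ l → l ∈ lits matrix → ∀ v v' → v ∈ varsLit l → v' ∈ varsLit l →
          XVar v → XVar v' → v ≡ v'

  CondII : Set
  CondII = ∀ x x' i i' → x ≢ x' → IsX prefix x i → IsX prefix x' i' → i ≤ i' →
           ∀ y j → IsY prefix y j → i ≤ j →
           ¬ (varsOf (L x) y × varsOf (L x') y)

-- Every literal of ℒ_x contains x itself or a y-variable of index ≥ idx(x): rule (a)
-- puts x in the literal, and rule (b) adds literals of ⋓_y with idx(y) ≥ idx(x),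
-- while the edges of 𝒢_φ never decrease the index. Hence a literal shared by ℒ_x and
-- ℒ_x' contains either two universal variables, contradicting (I), or a late
-- existential variable common to both, contradicting (II); the same dichotomy gives
-- (ii). Part (iii) holds because rule (b) would absorb any literal of ℒ₀ sharing a
-- variable of Y_x into ℒ_x, and (iv) is hypothesis (II) itself.
module Submission where

open import Defs
open import Data.Nat using (ℕ; suc; _≤_)
open import Data.Nat.Properties using (≤-refl; ≤-trans; ≤-total; _≟_)
open import Data.Product using (_×_; _,_; ∃-syntax; swap)
open import Data.Sum using (_⊎_; inj₁; inj₂)
open import Data.Empty using (⊥-elim)
open import Function using (_∘_)
open import Data.List using (List; []; _∷_; _++_)
open import Data.List.Properties using (++-assoc)
open import Data.List.Membership.Propositional using (_∈_; find)
open import Data.List.Membership.Propositional.Properties using (∈-++⁺ˡ; ∈-++⁺ʳ; ∈-concatMap⁻)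
open import Data.List.Relation.Unary.Any using (here; there)
open import Data.List.Relation.Unary.All as All using ()
open import Data.List.Relation.Unary.All.Properties using (++⁻ʳ)
open import Data.List.Relation.Unary.AllPairs using (_∷_)
open import Data.List.Relation.Unary.Unique.Propositional using (Unique)
open import Data.List.Relation.Binary.Disjoint.Propositional using (Disjoint)
open import Relation.Binary.PropositionalEquality using (_≡_; _≢_; refl; sym; cong; subst)
open import Relation.Nullary using (¬_; yes; no)

module _ {A : Set} where

  Unique-++⁻ʳ : ∀ (xs : List A) {ys} → Unique (xs ++ ys) → Unique ys
  Unique-++⁻ʳ []       u       = u
  Unique-++⁻ʳ (_ ∷ xs) (_ ∷ u) = Unique-++⁻ʳ xs u

  Unique-++⇒Disjoint : ∀ (xs : List A) {ys} → Unique (xs ++ ys) → Disjoint xs ys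
  Unique-++⇒Disjoint (_ ∷ xs) (x≢ ∷ _) (here refl , v∈ys) = All.lookup (++⁻ʳ xs x≢) v∈ys refl
  Unique-++⇒Disjoint (_ ∷ xs) (_ ∷ u)  (there v∈xs , v∈ys) = Unique-++⇒Disjoint xs u (v∈xs , v∈ys)

data BoundIn : List Block → Var → ℕ → Set where
  here  : ∀ {xs ys bs v} → v ∈ xs ++ ys → BoundIn ((xs , ys) ∷ bs) v 1
  there : ∀ {b bs v k} → BoundIn bs v k → BoundIn (b ∷ bs) v (suc k)

IsX⇒BoundIn : ∀ {bs v k} → IsX bs v k → BoundIn bs v k
IsX⇒BoundIn (here v∈xs) = here (∈-++⁺ˡ v∈xs)
IsX⇒BoundIn (there p)   = there (IsX⇒BoundIn p)

IsY⇒BoundIn : ∀ {bs v k} → IsY bs v k → BoundIn bs v k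
IsY⇒BoundIn (here {b = xs , _} v∈ys) = here (∈-++⁺ʳ xs v∈ys)
IsY⇒BoundIn (there p)                = there (IsY⇒BoundIn p)

BoundIn⇒∈allVars : ∀ {bs v k} → BoundIn bs v k → v ∈ allVars bs
BoundIn⇒∈allVars {bs = (xs , ys) ∷ bs} {v} (here p) =
  subst (v ∈_) (++-assoc xs ys (allVars bs)) (∈-++⁺ˡ p)
BoundIn⇒∈allVars {bs = (xs , ys) ∷ _} (there p) = ∈-++⁺ʳ xs (∈-++⁺ʳ ys (BoundIn⇒∈allVars p))

BoundIn-index-unique : ∀ {bs v k k'} → Unique (allVars bs) →
                       BoundIn bs v k → BoundIn bs v k' → k ≡ k'
BoundIn-index-unique u (here p) (here q) = refl
BoundIn-index-unique {bs = (xs , ys) ∷ bs} u (here p) (there q) =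
  ⊥-elim (Unique-++⇒Disjoint (xs ++ ys) u′ (p , BoundIn⇒∈allVars q))
  where
  u′ : Unique ((xs ++ ys) ++ allVars bs)
  u′ = subst Unique (sym (++-assoc xs ys (allVars bs))) u
BoundIn-index-unique u (there p) (here {xs} {ys} q) =
  sym (BoundIn-index-unique u (here {xs = xs} {ys} q) (there p))
BoundIn-index-unique {bs = (xs , ys) ∷ _} u (there p) (there q) =
  cong suc (BoundIn-index-unique (Unique-++⁻ʳ ys (Unique-++⁻ʳ xs u)) p q)

IsX-index-unique : ∀ {bs v k k'} → Unique (allVars bs) → IsX bs v k → IsX bs v k' → k ≡ k'
IsX-index-unique u p q = BoundIn-index-unique u (IsX⇒BoundIn p) (IsX⇒BoundIn q)

IsY-index-unique : ∀ {bs v k k'} → Unique (allVars bs) → IsY bs v k → IsY bs v k' → k ≡ k'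
IsY-index-unique u p q = BoundIn-index-unique u (IsY⇒BoundIn p) (IsY⇒BoundIn q)

module _ (φ : Sentence) where
  open Sentence φ

  ContainsYFrom : ℕ → Literal → Set
  ContainsYFrom i l = ∃[ y ] (y ∈ varsLit l × ∃[ j ] (IsY prefix y j × i ≤ j))

  L⊆lits : ∀ {x l} → L φ x l → l ∈ lits matrix
  L⊆lits (ruleA l∈ψ _)             = l∈ψ
  L⊆lits (ruleB _ _ _ _ _ (l∈ψ , _)) = l∈ψ

  Yx∩varsL0≡∅ : ∀ x → XVar φ x → ∀ y → ¬ (Yx φ x y × varsOf φ (L0 φ) y)
  Yx∩varsL0≡∅ x x∈X y
    (((l , l∈Lx , y∈l) , i , j , px , py , i≤j) , (l₀ , (l₀∈ψ , l₀∉L) , y∈l₀)) =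
    l₀∉L x x∈X (ruleB l∈Lx y∈l py px i≤j (l₀∈ψ , y , base (j , py) , y∈l₀))

  module _ (wf : WellFormed φ) where
    open WellFormed wf

    x∈varsLx : ∀ x → XVar φ x → varsOf φ (L φ x) x
    x∈varsLx x (_ , px) =
      let l , l∈ψ , x∈l = find (∈-concatMap⁻ varsLit x∈ψ) in l , ruleA l∈ψ x∈l , x∈l
      where
      x∈ψ : x ∈ varsQF matrix
      x∈ψ = prefixOccurs x (BoundIn⇒∈allVars (IsX⇒BoundIn px))

    Up-index-mono : ∀ {y z j} → Up φ y z → IsY prefix y j → ∃[ k ] (IsY prefix z k × j ≤ k)
    Up-index-mono (base _) py = _ , py , ≤-refl
    Up-index-mono (step y↑z (_ , k' , pz , pz' , i≤k' , _)) py with Up-index-mono y↑z py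
    ... | k , pz″ , j≤k rewrite IsY-index-unique noDoubleBind pz″ pz = k' , pz' , ≤-trans j≤k i≤k'

    L-anchored : ∀ {x i l} → L φ x l → IsX prefix x i → x ∈ varsLit l ⊎ ContainsYFrom i l
    L-anchored (ruleA _ x∈l) _ = inj₁ x∈l
    L-anchored (ruleB _ _ py px i≤j (_ , z , y↑z , z∈l)) px′ with Up-index-mono y↑z py
    ... | k , pz , j≤k rewrite IsX-index-unique noDoubleBind px′ px =
      inj₂ (z , z∈l , k , pz , ≤-trans i≤j j≤k)

    module _ (condII : CondII φ) where

      CondII-sym : ∀ {x x' i i' y j} → x ≢ x' → IsX prefix x i → IsX prefix x' i' →
                   IsY prefix y j → i ≤ j → ¬ (varsOf φ (L φ x) y × varsOf φ (L φ x') y)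
      CondII-sym {i = i} {i'} x≢x' px px' py i≤j shared with ≤-total i i'
      ... | inj₁ i≤i' = condII _ _ _ _ x≢x' px px' i≤i' _ _ py i≤j shared
      ... | inj₂ i'≤i =
        condII _ _ _ _ (x≢x' ∘ sym) px' px i'≤i _ _ py (≤-trans i'≤i i≤j) (swap shared)

      Yx∩varsL≡∅ : ∀ x x' i i' → x ≢ x' → IsX prefix x i → IsX prefix x' i' → i ≤ i' →
                   ∀ y → ¬ (Yx φ x y × varsOf φ (L φ x') y)
      Yx∩varsL≡∅ x x' i i' x≢x' px px' i≤i' y ((y∈Lx , _ , j , px″ , py , i≤j) , y∈Lx')
        rewrite IsX-index-unique noDoubleBind px″ px =
          condII x x' i i' x≢x' px px' i≤i' y j py i≤j (y∈Lx , y∈Lx')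

      module _ (condI : CondI φ) where

        L-disjoint : ∀ x x' → XVar φ x → XVar φ x' → x ≢ x' → ∀ l → ¬ (L φ x l × L φ x' l)
        L-disjoint x x' (i , px) (i' , px') x≢x' l (l∈Lx , l∈Lx')
          with L-anchored l∈Lx px | L-anchored l∈Lx' px'
        ... | inj₁ x∈l | inj₁ x'∈l = x≢x' (condI l (L⊆lits l∈Lx) x x' x∈l x'∈l (i , px) (i' , px'))
        ... | inj₂ (y , y∈l , j , py , i≤j) | _ =
          CondII-sym x≢x' px px' py i≤j ((l , l∈Lx , y∈l) , (l , l∈Lx' , y∈l))
        ... | _ | inj₂ (y , y∈l , j , py , i'≤j) =
          CondII-sym (x≢x' ∘ sym) px' px py i'≤j ((l , l∈Lx' , y∈l) , (l , l∈Lx , y∈l))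


        varsLx∩X≡x : ∀ x → XVar φ x → ∀ v → varsOf φ (L φ x) v → XVar φ v → v ≡ x
        varsLx∩X≡x x (i , px) v (l , l∈Lx , v∈l) (k , pv) with L-anchored l∈Lx px
        ... | inj₁ x∈l = condI l (L⊆lits l∈Lx) v x v∈l x∈l (k , pv) (i , px)
        ... | inj₂ (y , y∈l , j , py , i≤j) with v ≟ x
        ...   | yes v≡x = v≡x
        ...   | no v≢x  = ⊥-elim (CondII-sym (v≢x ∘ sym) px pv py i≤j
                                   ((l , l∈Lx , y∈l) , (l , ruleA (L⊆lits l∈Lx) v∈l , y∈l)))

lemma9 : (φ : Sentence) → WellFormed φ → CondI φ → CondII φ →
    (∀ x x' → XVar φ x → XVar φ x' → x ≢ x' → ∀ l → ¬ (L φ x l × L φ x' l))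
    × (∀ x → XVar φ x → varsOf φ (L φ x) x × (∀ v → varsOf φ (L φ x) v → XVar φ v → v ≡ x))
    × (∀ x → XVar φ x → ∀ y → ¬ (Yx φ x y × varsOf φ (L0 φ) y))
    × (∀ x x' i i' → x ≢ x' → IsX (Sentence.prefix φ) x i → IsX (Sentence.prefix φ) x' i' → i ≤ i' →
        ∀ y → ¬ (Yx φ x y × varsOf φ (L φ x') y))
lemma9 φ wf condI condII =
    L-disjoint φ wf condII condI
  , (λ x x∈X → x∈varsLx φ wf x x∈X , varsLx∩X≡x φ wf condII condI x x∈X)
  , Yx∩varsL0≡∅ φ
  , Yx∩varsL≡∅ φ wf condII
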